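{- Let $k,n$ be positive integers with $n\geq k$, and let $\nu$ and $\tilde\nu$ be the equal-slices and non-degenerate equal-slices measures on $[k]^n$. Then for every $A\subseteq[k]^n$, $|\nu(A)-\tilde\nu(A)|\leq k^2/n$.
   Context: Equal-slices measure $\nu$ on $[k]^n$: choose uniformly a $k$-tuple $(a_1,\dots,a_k)$ of non-negative integers summing to $n$, then choose $x$ uniformly among sequences with exactly $a_j$ coordinates equal to $j$ for each $j$. Non-degenerate equal-slices measure $\tilde\nu$: the same, but $(a_1,\dots,a_k)$ is chosen uniformly among $k$-tuples of positive integers summing to $n$ (equivalently, $\nu$ conditioned on every value $j\in[k]$ occurring in $x$). -}

module Defs where

import Data.Bool
open import Data.Bool using (Bool; true; false; _∧_; if_then_else_)
open import Data.Nat as ℕ using (ℕ; zero; suc; _≡ᵇ_)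
open import Data.Fin using (Fin; toℕ)
open import Data.Fin.Properties using (_≟_)
open import Data.List as L using (List; []; _∷_; concatMap; filter; length; allFin)
open import Data.Vec as V using (Vec; []; _∷_; tabulate)
open import Data.Integer using (+_)
open import Data.Rational using (ℚ; 0ℚ; _/_; _+_; _*_)
open import Relation.Nullary.Decidable using (⌊_⌋)
open import Relation.Unary using (Pred)

-- Safe division of naturals into ℚ (value irrelevant when the denominator is 0;
-- it is only ever applied to nonzero denominators below).
_÷_ : ℕ → ℕ → ℚ
p ÷ zero = 0ℚ
p ÷ suc q = (+ p) / suc q

allSeqs : (k n : ℕ) → List (Vec (Fin k) n)
allSeqs k zero = [] ∷ []
allSeqs k (suc n) = concatMap (λ i → L.map (i ∷_) (allSeqs k n)) (allFin k)

count : ∀ {k n} → Fin k → Vec (Fin k) n → ℕ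
count j [] = 0
count j (x ∷ xs) = if ⌊ x ≟ j ⌋ then suc (count j xs) else count j xs

profile : ∀ {k n} → Vec (Fin k) n → Vec ℕ k
profile x = tabulate (λ j → count j x)

vecEqᵇ : ∀ {m} → Vec ℕ m → Vec ℕ m → Bool
vecEqᵇ [] [] = true
vecEqᵇ (a ∷ as) (b ∷ bs) = (a ≡ᵇ b) ∧ vecEqᵇ as bs

compositions : (k n : ℕ) → List (Vec ℕ k)
compositions k n =
  filter (λ a → V.sum a ℕ.≟ n) (L.map (V.map toℕ) (allSeqs (suc n) k))

allPositiveᵇ : ∀ {m} → Vec ℕ m → Bool
allPositiveᵇ [] = true
allPositiveᵇ (zero ∷ as) = false
allPositiveᵇ (suc _ ∷ as) = allPositiveᵇ as

positiveCompositions : (k n : ℕ) → List (Vec ℕ k)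
positiveCompositions k n =
  filter (λ a → Data.Bool._≟_ (allPositiveᵇ a) true) (compositions k n)

Subset : (k n : ℕ) → Set
Subset k n = Vec (Fin k) n → Bool

slice : ∀ k n → Vec ℕ k → List (Vec (Fin k) n)
slice k n a = L.filter (λ x → Data.Bool._≟_ (vecEqᵇ (profile x) a) true) (allSeqs k n)

sliceDensity : ∀ k n → Subset k n → Vec ℕ k → ℚ
sliceDensity k n A a =
  length (L.filter (λ x → Data.Bool._≟_ (A x) true) (slice k n a)) ÷ length (slice k n a)

sumℚ : List ℚ → ℚ
sumℚ = L.foldr _+_ 0ℚ

-- measure of A when the slice a is chosen uniformly from the list cs
averageOver : ∀ k n → List (Vec ℕ k) → Subset k n → ℚ
averageOver k n cs A = (1 ÷ length cs) * sumℚ (L.map (sliceDensity k n A) cs)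

equalSlices : ∀ k n → Subset k n → ℚ
equalSlices k n = averageOver k n (compositions k n)

nondegEqualSlices : ∀ k n → Subset k n → ℚ
nondegEqualSlices k n = averageOver k n (positiveCompositions k n)

-- Let N and P count the compositions of n into k non-negative, resp. positive, parts and
-- M = N - P.  Both measures average the slice densities, which lie in [0, 1]: ν over all N
-- compositions, ν̃ over the P positive ones, so they differ by at most M / N.  A composition
-- with a zero part has it in one of k places, and deleting it leaves a composition of n into
-- k - 1 parts, so M ≤ k C(n + k - 2, k - 2).  By the absorption identity for binomial
-- coefficients n C(n + k - 2, k - 2) ≤ k C(n + k - 1, k - 1) = k N, hence M / N ≤ k² / n.
module Submission where

open import Defs

module CompositionCounts where

  open import Data.Nat as ℕ
  open import Data.Nat.Properties
  open import Data.Nat.Solver using (module +-*-Solver)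
  open import Relation.Binary.PropositionalEquality
  open import Data.Sum using (inj₁; inj₂)
  open import Function using (_∘_; id)
  open import Data.Fin using (Fin; toℕ)
  open import Data.List as L using (List; []; _∷_; _++_; length; filter; concatMap; allFin)
  open import Data.Nat.ListAction using (sum)
  open import Data.List.Properties using (filter-≐; filter-none; filter-++; length-++; map-cong; map-tabulate)
  open import Data.Vec as V using (Vec; _∷_)
  open import Data.Bool as Bool using (true; false)
  open import Data.Product using (_×_; _,_; proj₂; map₂)
  import Data.List.Relation.Unary.All as All
  open import Relation.Nullary using (yes; no; does; ¬_)
  open import Relation.Unary using (Pred; Decidable; _≐_)
  open import Relation.Unary.Properties using (_∩?_)

  open +-*-Solver

  sumTo : (ℕ → ℕ) → ℕ → ℕ
  sumTo f zero = 0
  sumTo f (suc s) = sumTo f s + f s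

  sumTo-≤-+* : ∀ f g h m s → (∀ j → f j ≤ g j + m * h j) → sumTo f s ≤ sumTo g s + m * sumTo h s
  sumTo-≤-+* f g h m zero f≤ = z≤n
  sumTo-≤-+* f g h m (suc s) f≤ = begin
    sumTo f s + f s                                ≤⟨ +-mono-≤ (sumTo-≤-+* f g h m s f≤) (f≤ s) ⟩
    (sumTo g s + m * sumTo h s) + (g s + m * h s)  ≡⟨ solve 5 (λ a b c d m → (a :+ m :* b) :+ (c :+ m :* d)
                                                                := (a :+ c) :+ m :* (b :+ d))
                                                         refl (sumTo g s) (sumTo h s) (g s) (h s) m ⟩
    (sumTo g s + g s) + m * (sumTo h s + h s)      ∎
    where open ≤-Reasoning

  sumTo-cong : ∀ {f g} s → (∀ j → j < s → f j ≡ g j) → sumTo f s ≡ sumTo g s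
  sumTo-cong zero f≡g = refl
  sumTo-cong (suc s) f≡g = cong₂ _+_ (sumTo-cong s (λ j j<s → f≡g j (m≤n⇒m≤1+n j<s))) (f≡g s ≤-refl)

  sumTo-suc : ∀ f s → sumTo f (suc s) ≡ f 0 + sumTo (f ∘ suc) s
  sumTo-suc f zero = +-comm 0 (f 0)
  sumTo-suc f (suc s) = trans (cong (_+ f (suc s)) (sumTo-suc f s)) (+-assoc (f 0) _ _)

  sumTo-reverse : ∀ f s → sumTo (λ j → f (s ∸ j)) (suc s) ≡ sumTo f (suc s)
  sumTo-reverse f zero = refl
  sumTo-reverse f (suc s) = begin
    sumTo (λ j → f (suc s ∸ j)) (suc (suc s))  ≡⟨ sumTo-suc (λ j → f (suc s ∸ j)) (suc s) ⟩
    f (suc s) + sumTo (λ j → f (s ∸ j)) (suc s) ≡⟨ cong (f (suc s) +_) (sumTo-reverse f s) ⟩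
    f (suc s) + sumTo f (suc s)                 ≡⟨ +-comm (f (suc s)) _ ⟩
    sumTo f (suc (suc s))                       ∎
    where open ≡-Reasoning

  sumTo-vanishing : ∀ f {s B} → s ≤ B → (∀ j → s ≤ j → f j ≡ 0) → sumTo f B ≡ sumTo f s
  sumTo-vanishing f {B = zero} z≤n f≡0 = refl
  sumTo-vanishing f {B = suc B} s≤1+B f≡0 with m≤n⇒m<n∨m≡n s≤1+B
  ... | inj₁ (s≤s s≤B) = trans (cong₂ _+_ (sumTo-vanishing f s≤B f≡0) (f≡0 B s≤B)) (+-identityʳ _)
  ... | inj₂ refl = refl

  sumTo-reflect : ∀ f g {s B} → s < B → (∀ j → j ≤ s → g j ≡ f (s ∸ j)) → (∀ j → s < j → g j ≡ 0) →
                  sumTo g B ≡ sumTo f (suc s)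
  sumTo-reflect f g {s} {B} s<B g≡f g≡0 = begin
    sumTo g B                       ≡⟨ sumTo-vanishing g s<B g≡0 ⟩
    sumTo g (suc s)                 ≡⟨ sumTo-cong (suc s) (λ j j<1+s → g≡f j (≤-pred j<1+s)) ⟩
    sumTo (λ j → f (s ∸ j)) (suc s) ≡⟨ sumTo-reverse f s ⟩
    sumTo f (suc s)                 ∎
    where open ≡-Reasoning

  -- #comp k s and #comp⁺ k s count the k-tuples of non-negative, resp. positive,
  -- integers summing to s; #comp (1 + k) s = C(s + k, k).
  #comp : ℕ → ℕ → ℕ
  #comp zero zero = 1
  #comp zero (suc s) = 0
  #comp (suc k) s = sumTo (#comp k) (suc s)

  #comp⁺ : ℕ → ℕ → ℕ
  #comp⁺ zero = #comp zero
  #comp⁺ (suc k) s = sumTo (#comp⁺ k) s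

  #comp[k,0]≡1 : ∀ k → #comp k 0 ≡ 1
  #comp[k,0]≡1 zero = refl
  #comp[k,0]≡1 (suc k) = #comp[k,0]≡1 k

  #comp[k,1]≡k : ∀ k → #comp k 1 ≡ k
  #comp[k,1]≡k zero = refl
  #comp[k,1]≡k (suc k) = cong₂ _+_ (#comp[k,0]≡1 k) (#comp[k,1]≡k k)

  #comp[1,s]≡1 : ∀ s → #comp 1 s ≡ 1
  #comp[1,s]≡1 zero = refl
  #comp[1,s]≡1 (suc s) = trans (+-identityʳ _) (#comp[1,s]≡1 s)

  #comp-absorption : ∀ m s → m * #comp (suc m) s ≡ suc s * #comp m (suc s)
  #comp-absorption zero s = sym (*-zeroʳ (suc s))
  #comp-absorption (suc m) zero = begin
    suc m * #comp (suc (suc m)) 0  ≡⟨ cong (suc m *_) (#comp[k,0]≡1 (suc (suc m))) ⟩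
    suc m * 1                      ≡⟨ *-identityʳ (suc m) ⟩
    1 + m                          ≡⟨ sym (cong₂ _+_ (#comp[k,0]≡1 m) (#comp[k,1]≡k m)) ⟩
    #comp (suc m) 1                ≡⟨ sym (*-identityˡ _) ⟩
    1 * #comp (suc m) 1            ∎
    where open ≡-Reasoning
  #comp-absorption (suc m) (suc s) = begin
    suc m * (#comp (suc (suc m)) s + x)        ≡⟨ *-distribˡ-+ (suc m) (#comp (suc (suc m)) s) x ⟩
    suc m * #comp (suc (suc m)) s + suc m * x  ≡⟨ cong (_+ suc m * x) (#comp-absorption (suc m) s) ⟩
    suc s * x + suc m * x                      ≡⟨ solve 3 (λ s m x → (con 1 :+ s) :* x :+ (con 1 :+ m) :* x
                                                                   := (con 2 :+ s) :* x :+ m :* x) refl s m x ⟩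
    suc (suc s) * x + m * x                    ≡⟨ cong (suc (suc s) * x +_) (#comp-absorption m (suc s)) ⟩
    suc (suc s) * x + suc (suc s) * y          ≡⟨ sym (*-distribˡ-+ (suc (suc s)) x y) ⟩
    suc (suc s) * (x + y)                      ∎
    where
    open ≡-Reasoning
    x y : ℕ
    x = #comp (suc m) (suc s)
    y = #comp m (suc (suc s))

  -- A composition of s into k+1 parts is either positive or has a zero part; fixing the
  -- position of that zero leaves a composition of s into k parts.
  #comp-union-bound : ∀ k s → #comp (suc k) s ≤ #comp⁺ (suc k) s + suc k * #comp k s
  #comp-union-bound zero zero = s≤s z≤n
  #comp-union-bound zero (suc s) = begin
    #comp 1 (suc s)             ≡⟨ trans (#comp[1,s]≡1 (suc s)) (sym (#comp[1,s]≡1 s)) ⟩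
    #comp⁺ 1 (suc s)            ≤⟨ m≤m+n _ _ ⟩
    #comp⁺ 1 (suc s) + 1 * 0    ∎
    where open ≤-Reasoning
  #comp-union-bound (suc k) s = begin
    sumTo (#comp (suc k)) s + #comp (suc k) s
      ≤⟨ +-monoˡ-≤ _ (sumTo-≤-+* (#comp (suc k)) (#comp⁺ (suc k)) (#comp k) (suc k) s (#comp-union-bound k)) ⟩
    (#comp⁺ (suc (suc k)) s + suc k * sumTo (#comp k) s) + #comp (suc k) s
      ≤⟨ +-monoˡ-≤ _ (+-monoʳ-≤ (#comp⁺ (suc (suc k)) s) (*-monoʳ-≤ (suc k) (m≤m+n _ (#comp k s)))) ⟩
    (#comp⁺ (suc (suc k)) s + suc k * #comp (suc k) s) + #comp (suc k) s
      ≡⟨ solve 3 (λ a k c → (a :+ (con 1 :+ k) :* c) :+ c := a :+ (con 2 :+ k) :* c)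
               refl (#comp⁺ (suc (suc k)) s) k (#comp (suc k) s) ⟩
    #comp⁺ (suc (suc k)) s + suc (suc k) * #comp (suc k) s ∎
    where open ≤-Reasoning

  n*#comp[j,n]≤[1+j]*#comp[1+j,n] : ∀ j n → n * #comp j n ≤ suc j * #comp (suc j) n
  n*#comp[j,n]≤[1+j]*#comp[1+j,n] j zero = z≤n
  n*#comp[j,n]≤[1+j]*#comp[1+j,n] j (suc t) = begin
    suc t * #comp j (suc t)     ≡⟨ sym (#comp-absorption j t) ⟩
    j * #comp (suc j) t         ≤⟨ *-monoʳ-≤ j (m≤m+n _ _) ⟩
    j * #comp (suc j) (suc t)   ≤⟨ *-monoˡ-≤ _ (n≤1+n j) ⟩
    suc j * #comp (suc j) (suc t) ∎
    where open ≤-Reasoning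

  #comp⁺-pos : ∀ j n → suc j ≤ n → 1 ≤ #comp⁺ (suc j) n
  #comp⁺-pos zero (suc t) _ = ≤-reflexive (sym (#comp[1,s]≡1 t))
  #comp⁺-pos (suc j) (suc t) (s≤s j<t) = ≤-trans (#comp⁺-pos j t j<t) (m≤n+m _ _)

  degenerate-bound : ∀ j n M → #comp (suc j) n ≡ #comp⁺ (suc j) n + M →
                     n * M ≤ (suc j * suc j) * #comp (suc j) n
  degenerate-bound j n M eq = begin
    n * M                            ≤⟨ *-monoʳ-≤ n M≤ ⟩
    n * (suc j * #comp j n)          ≡⟨ solve 3 (λ n a b → n :* (a :* b) := a :* (n :* b)) refl n (suc j) (#comp j n) ⟩
    suc j * (n * #comp j n)          ≤⟨ *-monoʳ-≤ (suc j) (n*#comp[j,n]≤[1+j]*#comp[1+j,n] j n) ⟩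
    suc j * (suc j * #comp (suc j) n) ≡⟨ sym (*-assoc (suc j) (suc j) _) ⟩
    (suc j * suc j) * #comp (suc j) n ∎
    where
    open ≤-Reasoning
    M≤ : M ≤ suc j * #comp j n
    M≤ = +-cancelˡ-≤ (#comp⁺ (suc j) n) M _ (subst (_≤ #comp⁺ (suc j) n + suc j * #comp j n) eq (#comp-union-bound j n))

  module _ {a p} {A : Set a} {P : Pred A p} (P? : Decidable P) where

    #filter : List A → ℕ
    #filter xs = length (filter P? xs)

    #filter-map : ∀ {b} {B : Set b} (f : B → A) xs → #filter (L.map f xs) ≡ length (filter (P? ∘ f) xs)
    #filter-map f [] = refl
    #filter-map f (x ∷ xs) with P? (f x)
    ... | yes _ = cong suc (#filter-map f xs)
    ... | no _ = #filter-map f xs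

    #filter-concatMap : ∀ {b} {B : Set b} (h : B → List A) xs →
                              #filter (concatMap h xs) ≡ sum (L.map (#filter ∘ h) xs)
    #filter-concatMap h [] = refl
    #filter-concatMap h (x ∷ xs) = begin
      length (filter P? (h x ++ concatMap h xs))              ≡⟨ cong length (filter-++ P? (h x) _) ⟩
      length (filter P? (h x) ++ filter P? (concatMap h xs))  ≡⟨ length-++ (filter P? (h x)) ⟩
      #filter (h x) + #filter (concatMap h xs)                    ≡⟨ cong (#filter (h x) +_) (#filter-concatMap h xs) ⟩
      #filter (h x) + sum (L.map (#filter ∘ h) xs)              ∎
      where open ≡-Reasoning

  module _ {a p q} {A : Set a} {P : Pred A p} {Q : Pred A q} (P? : Decidable P) (Q? : Decidable Q) where

    filter-filter : ∀ xs → filter P? (filter Q? xs) ≡ filter (P? ∩? Q?) xs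
    filter-filter [] = refl
    filter-filter (x ∷ xs) with does (Q? x)
    ... | false with does (P? x)
    ...   | true  = filter-filter xs
    ...   | false = filter-filter xs
    filter-filter (x ∷ xs) | true with does (P? x)
    ...   | true  = cong (x ∷_) (filter-filter xs)
    ...   | false = filter-filter xs

  boundedVecs : ℕ → (k : ℕ) → List (Vec ℕ k)
  boundedVecs B k = L.map (V.map toℕ) (allSeqs B k)

  sum-tabulate-toℕ : ∀ (f : ℕ → ℕ) B → sum (L.tabulate {n = B} (f ∘ toℕ)) ≡ sumTo f B
  sum-tabulate-toℕ f zero = refl
  sum-tabulate-toℕ f (suc B) = trans (cong (f 0 +_) (sum-tabulate-toℕ (f ∘ suc) B)) (sym (sumTo-suc f B))

  #filter-boundedVecs-suc : ∀ {p} B k {P : Pred (Vec ℕ (suc k)) p} (P? : Decidable P) →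
    #filter P? (boundedVecs B (suc k)) ≡ sumTo (λ j → #filter (P? ∘ (j ∷_)) (boundedVecs B k)) B
  #filter-boundedVecs-suc B k P? = begin
    #filter P? (L.map toVec (concatMap rows (allFin B)))  ≡⟨ #filter-map P? toVec (concatMap rows (allFin B)) ⟩
    #filter (P? ∘ toVec) (concatMap rows (allFin B))      ≡⟨ #filter-concatMap (P? ∘ toVec) rows (allFin B) ⟩
    sum (L.map (#filter (P? ∘ toVec) ∘ rows) (allFin B)) ≡⟨ cong sum (map-cong row-count (allFin B)) ⟩
    sum (L.map (H ∘ toℕ) (allFin B))                  ≡⟨ cong sum (map-tabulate {n = B} id (H ∘ toℕ)) ⟩
    sum (L.tabulate {n = B} (H ∘ toℕ))                ≡⟨ sum-tabulate-toℕ H B ⟩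
    sumTo H B                                           ∎
    where
    open ≡-Reasoning
    toVec : ∀ {m} → Vec (Fin B) m → Vec ℕ m
    toVec = V.map toℕ
    rows : Fin B → List (Vec (Fin B) (suc k))
    rows i = L.map (i ∷_) (allSeqs B k)
    H : ℕ → ℕ
    H j = #filter (P? ∘ (j ∷_)) (boundedVecs B k)
    row-count : ∀ i → #filter (P? ∘ toVec) (rows i) ≡ H (toℕ i)
    row-count i = trans (#filter-map (P? ∘ toVec) (i ∷_) (allSeqs B k))
                        (sym (#filter-map (P? ∘ (toℕ i ∷_)) toVec (allSeqs B k)))

  sum≟ : ∀ {k} s → Decidable (λ (a : Vec ℕ k) → V.sum a ≡ s)
  sum≟ s a = V.sum a ≟ s

  positive? : ∀ {k} → Decidable (λ (a : Vec ℕ k) → allPositiveᵇ a ≡ true)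
  positive? a = allPositiveᵇ a Bool.≟ true

  j+x≡s≐x≡s∸j : ∀ {k} {j s} → j ≤ s → (λ (v : Vec ℕ k) → j + V.sum v ≡ s) ≐ (λ v → V.sum v ≡ s ∸ j)
  j+x≡s≐x≡s∸j {j = j} {s} j≤s = (λ {v} eq → trans (sym (m+n∸m≡n j (V.sum v))) (cong (_∸ j) eq))
                        , (λ eq → trans (cong (j +_) eq) (m+[n∸m]≡n j≤s))

  s<j⇒j+x≢s : ∀ {j s} x → s < j → j + x ≢ s
  s<j⇒j+x≢s {j} x s<j eq = <⇒≱ s<j (subst (j ≤_) eq (m≤m+n j x))

  #filter-none : ∀ {a p} {A : Set a} {P : Pred A p} (P? : Decidable P) → (∀ x → ¬ P x) → ∀ xs → #filter P? xs ≡ 0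
  #filter-none P? ¬P xs = cong length (filter-none P? (All.universal ¬P xs))

  #filter-sum≟ : ∀ B k s → s < B → #filter (sum≟ s) (boundedVecs B k) ≡ #comp k s
  #filter-sum≟ B zero zero s<B = refl
  #filter-sum≟ B zero (suc s) s<B = refl
  #filter-sum≟ B (suc k) s s<B =
    trans (#filter-boundedVecs-suc B k (sum≟ s)) (sumTo-reflect (#comp k) _ s<B first≤s s<first)
    where
    first≤s : ∀ j → j ≤ s → #filter (sum≟ s ∘ (j ∷_)) (boundedVecs B k) ≡ #comp k (s ∸ j)
    first≤s j j≤s = trans (cong length (filter-≐ (sum≟ s ∘ (j ∷_)) (sum≟ (s ∸ j)) (j+x≡s≐x≡s∸j j≤s)
                                                 (boundedVecs B k)))
                          (#filter-sum≟ B k (s ∸ j) (≤-<-trans (m∸n≤m s j) s<B))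
    s<first : ∀ j → s < j → #filter (sum≟ s ∘ (j ∷_)) (boundedVecs B k) ≡ 0
    s<first j s<j = #filter-none (sum≟ s ∘ (j ∷_)) (λ v → s<j⇒j+x≢s (V.sum v) s<j) (boundedVecs B k)

  #filter-positive-sum≟ : ∀ B k s → s < B → #filter (positive? ∩? sum≟ s) (boundedVecs B k) ≡ #comp⁺ k s
  #filter-positive-sum≟ B zero zero s<B = refl
  #filter-positive-sum≟ B zero (suc s) s<B = refl
  #filter-positive-sum≟ (suc B) (suc k) zero _ =
    trans (#filter-boundedVecs-suc (suc B) k (positive? ∩? sum≟ 0)) (sumTo-vanishing _ z≤n none)
    where
    none : ∀ j → 0 ≤ j → #filter ((positive? ∩? sum≟ 0) ∘ (j ∷_)) (boundedVecs (suc B) k) ≡ 0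
    none zero _ = #filter-none _ (λ v → λ ()) (boundedVecs (suc B) k)
    none (suc j) _ = #filter-none _ (λ v → s<j⇒j+x≢s (V.sum v) (s≤s z≤n) ∘ proj₂) (boundedVecs (suc B) k)
  #filter-positive-sum≟ (suc B) (suc k) (suc t) (s≤s t<B) = begin
    #filter P? (boundedVecs (suc B) (suc k))  ≡⟨ #filter-boundedVecs-suc (suc B) k P? ⟩
    sumTo g (suc B)                           ≡⟨ sumTo-suc g B ⟩
    g 0 + sumTo (g ∘ suc) B                   ≡⟨ cong (_+ sumTo (g ∘ suc) B) first≡0 ⟩
    sumTo (g ∘ suc) B                         ≡⟨ sumTo-reflect (#comp⁺ k) (g ∘ suc) t<B first≤t t<first ⟩
    #comp⁺ (suc k) (suc t)                    ∎
    where
    open ≡-Reasoning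
    P? : Decidable (λ (a : Vec ℕ (suc k)) → allPositiveᵇ a ≡ true × V.sum a ≡ suc t)
    P? = positive? ∩? sum≟ (suc t)
    g : ℕ → ℕ
    g j = #filter (P? ∘ (j ∷_)) (boundedVecs (suc B) k)
    first≡0 : g 0 ≡ 0
    first≡0 = #filter-none (P? ∘ (0 ∷_)) (λ v → λ ()) (boundedVecs (suc B) k)
    first≤t : ∀ j → j ≤ t → g (suc j) ≡ #comp⁺ k (t ∸ j)
    first≤t j j≤t = trans (cong length (filter-≐ (P? ∘ (suc j ∷_)) (positive? ∩? sum≟ (t ∸ j)) shift
                                                 (boundedVecs (suc B) k)))
                          (#filter-positive-sum≟ (suc B) k (t ∸ j) (s≤s (≤-trans (m∸n≤m t j) (<⇒≤ t<B))))
      where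
      shift : (λ v → allPositiveᵇ v ≡ true × suc j + V.sum v ≡ suc t)
            ≐ (λ v → allPositiveᵇ v ≡ true × V.sum v ≡ t ∸ j)
      shift = let (⇒ , ⇐) = j+x≡s≐x≡s∸j (s≤s j≤t) in (λ {v} → map₂ (⇒ {v})) , (λ {v} → map₂ (⇐ {v}))
    t<first : ∀ j → t < j → g (suc j) ≡ 0
    t<first j t<j = #filter-none (P? ∘ (suc j ∷_)) (λ v → s<j⇒j+x≢s (V.sum v) (s≤s t<j) ∘ proj₂) (boundedVecs (suc B) k)

  length-compositions : ∀ k n → length (compositions k n) ≡ #comp k n
  length-compositions k n = #filter-sum≟ (suc n) k n ≤-refl

  length-positiveCompositions : ∀ k n → length (positiveCompositions k n) ≡ #comp⁺ k n
  length-positiveCompositions k n =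
    trans (cong length (filter-filter positive? (sum≟ n) (boundedVecs (suc n) k)))
          (#filter-positive-sum≟ (suc n) k n ≤-refl)

module Means where

  open import Data.Nat as ℕ using (ℕ; zero; suc)
  import Data.Nat.Properties as ℕ
  open import Data.Integer as ℤ using (+_)
  import Data.Integer.Properties as ℤ
  open import Data.Rational hiding (_÷_)
  open import Data.Rational.Properties hiding (_≟_)
  import Data.Rational.Unnormalised as ℚᵘ
  import Data.Rational.Unnormalised.Properties as ℚᵘ
  open import Data.Rational.Solver using (module +-*-Solver)
  open import Data.List as L using (List; []; _∷_; length; filter)
  open import Data.Sum using (inj₁; inj₂)
  open import Function using (_∘_)
  open import Relation.Binary.PropositionalEquality
  open import Relation.Nullary using (yes; no)
  open import Relation.Nullary.Decidable using (¬?)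
  open import Relation.Unary using (Pred; Decidable)

  open +-*-Solver using (solve; _:+_; _:*_; _:-_; :-_; _:=_)

  ⟦_⟧ : ℕ → ℚ
  ⟦ m ⟧ = m ÷ 1

  toℚᵘ-÷ : ∀ m q → toℚᵘ (m ÷ suc q) ℚᵘ.≃ ℚᵘ.mkℚᵘ (+ m) q
  toℚᵘ-÷ m q = toℚᵘ-fromℚᵘ (ℚᵘ.mkℚᵘ (+ m) q)

  ÷≡⟦⟧*1÷ : ∀ m q → m ÷ suc q ≡ ⟦ m ⟧ * (1 ÷ suc q)
  ÷≡⟦⟧*1÷ m q = toℚᵘ-injective (ℚᵘ.≃-trans (toℚᵘ-÷ m q) (ℚᵘ.≃-sym (begin-equality
    toℚᵘ (⟦ m ⟧ * (1 ÷ suc q))            ≃⟨ toℚᵘ-homo-* ⟦ m ⟧ (1 ÷ suc q) ⟩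
    toℚᵘ ⟦ m ⟧ ℚᵘ.* toℚᵘ (1 ÷ suc q)      ≃⟨ ℚᵘ.*-cong (toℚᵘ-÷ m 0) (toℚᵘ-÷ 1 q) ⟩
    ℚᵘ.mkℚᵘ (+ m) 0 ℚᵘ.* ℚᵘ.mkℚᵘ (+ 1) q  ≃⟨ ℚᵘ.*≡* (cong₂ (λ a b → a ℤ.* + b) (ℤ.*-identityʳ (+ m))
                                                            (sym (ℕ.+-identityʳ (suc q)))) ⟩
    ℚᵘ.mkℚᵘ (+ m) q                       ∎)))
    where open ℚᵘ.≤-Reasoning

  ⟦⟧-homo-+ : ∀ a b → ⟦ a ℕ.+ b ⟧ ≡ ⟦ a ⟧ + ⟦ b ⟧
  ⟦⟧-homo-+ a b = toℚᵘ-injective (ℚᵘ.≃-trans (toℚᵘ-÷ (a ℕ.+ b) 0) (ℚᵘ.≃-sym (begin-equality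
    toℚᵘ (⟦ a ⟧ + ⟦ b ⟧)                   ≃⟨ toℚᵘ-homo-+ ⟦ a ⟧ ⟦ b ⟧ ⟩
    toℚᵘ ⟦ a ⟧ ℚᵘ.+ toℚᵘ ⟦ b ⟧             ≃⟨ ℚᵘ.+-cong (toℚᵘ-÷ a 0) (toℚᵘ-÷ b 0) ⟩
    ℚᵘ.mkℚᵘ (+ a) 0 ℚᵘ.+ ℚᵘ.mkℚᵘ (+ b) 0  ≃⟨ ℚᵘ.*≡* numerators ⟩
    ℚᵘ.mkℚᵘ (+ (a ℕ.+ b)) 0               ∎)))
    where
    open ℚᵘ.≤-Reasoning
    numerators : (+ a ℤ.* + 1 ℤ.+ + b ℤ.* + 1) ℤ.* + 1 ≡ + (a ℕ.+ b) ℤ.* + 1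
    numerators = trans (ℤ.*-identityʳ _) (trans (cong₂ ℤ._+_ (ℤ.*-identityʳ (+ a)) (ℤ.*-identityʳ (+ b)))
                                                 (sym (trans (ℤ.*-identityʳ _) (ℤ.pos-+ a b))))

  ⟦suc⟧*1÷suc≡1 : ∀ q → ⟦ suc q ⟧ * (1 ÷ suc q) ≡ 1ℚ
  ⟦suc⟧*1÷suc≡1 q = trans (sym (÷≡⟦⟧*1÷ (suc q) q))
    (toℚᵘ-injective (ℚᵘ.≃-trans (toℚᵘ-÷ (suc q) q)
      (ℚᵘ.*≡* (trans (ℤ.*-identityʳ (+ suc q)) (sym (ℤ.*-identityˡ (+ suc q)))))))

  ÷-nonNeg : ∀ a b → 0ℚ ≤ a ÷ b
  ÷-nonNeg a zero = ≤-refl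
  ÷-nonNeg a (suc b) = nonNegative⁻¹ _ {{normalize-nonNeg a (suc b)}}

  *≤*⇒÷≤÷ : ∀ a b c d → a ℕ.* suc d ℕ.≤ b ℕ.* c → a ÷ c ≤ b ÷ suc d
  *≤*⇒÷≤÷ a b zero d _ = ÷-nonNeg b (suc d)
  *≤*⇒÷≤÷ a b (suc c) d a*d≤b*c = toℚᵘ-cancel-≤
    (ℚᵘ.≤-respˡ-≃ (ℚᵘ.≃-sym (toℚᵘ-÷ a c)) (ℚᵘ.≤-respʳ-≃ (ℚᵘ.≃-sym (toℚᵘ-÷ b d))
      (ℚᵘ.*≤* (subst₂ ℤ._≤_ (ℤ.pos-* a (suc d)) (ℤ.pos-* b (suc c)) (ℤ.+≤+ a*d≤b*c)))))

  ⟦⟧-mono-≤ : ∀ {m n} → m ℕ.≤ n → ⟦ m ⟧ ≤ ⟦ n ⟧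
  ⟦⟧-mono-≤ {m} {n} m≤n = *≤*⇒÷≤÷ m n 1 0 (subst₂ ℕ._≤_ (sym (ℕ.*-identityʳ m)) (sym (ℕ.*-identityʳ n)) m≤n)

  ÷≤1 : ∀ {a b} → a ℕ.≤ b → a ÷ b ≤ 1ℚ
  ÷≤1 {a} {b} a≤b = *≤*⇒÷≤÷ a 1 b 0 (subst₂ ℕ._≤_ (sym (ℕ.*-identityʳ a)) (sym (ℕ.*-identityˡ b)) a≤b)

  module _ {a} {A : Set a} (f : A → ℚ) where

    sumℚ-nonNeg : (∀ x → 0ℚ ≤ f x) → ∀ xs → 0ℚ ≤ sumℚ (L.map f xs)
    sumℚ-nonNeg f≥0 [] = ≤-refl
    sumℚ-nonNeg f≥0 (x ∷ xs) = +-mono-≤ (f≥0 x) (sumℚ-nonNeg f≥0 xs)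

    sumℚ-≤-length : (∀ x → f x ≤ 1ℚ) → ∀ xs → sumℚ (L.map f xs) ≤ ⟦ length xs ⟧
    sumℚ-≤-length f≤1 [] = ≤-refl
    sumℚ-≤-length f≤1 (x ∷ xs) =
      subst (f x + sumℚ (L.map f xs) ≤_) (sym (⟦⟧-homo-+ 1 (length xs))) (+-mono-≤ (f≤1 x) (sumℚ-≤-length f≤1 xs))

  -q≤p≤q⇒∣p∣≤q : ∀ {p q} → - q ≤ p → p ≤ q → ∣ p ∣ ≤ q
  -q≤p≤q⇒∣p∣≤q {p} {q} -q≤p p≤q with ∣p∣≡p∨∣p∣≡-p p
  ... | inj₁ ∣p∣≡p = subst (_≤ q) (sym ∣p∣≡p) p≤q
  ... | inj₂ ∣p∣≡-p = subst₂ _≤_ (sym ∣p∣≡-p) (solve 1 (λ q → :- (:- q) := q) refl q) (neg-antimono-≤ -q≤p)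

  0≤p*q : ∀ {p q} → 0ℚ ≤ p → 0ℚ ≤ q → 0ℚ ≤ p * q
  0≤p*q {p} {q} 0≤p 0≤q = subst (_≤ p * q) (*-zeroʳ p) (*-monoˡ-≤-nonNeg p {{nonNegative 0≤p}} 0≤q)

  -- With y = S₁ / P ∈ [0, 1] the difference is (S₂ - M y) / N, where S₂ and M y both lie in [0, M].
  ∣mean-sub-mean∣≤ : ∀ {N P M} → N ≡ P ℕ.+ M → 0 ℕ.< P → ∀ {S₁ S₂} →
                     0ℚ ≤ S₁ → S₁ ≤ ⟦ P ⟧ → 0ℚ ≤ S₂ → S₂ ≤ ⟦ M ⟧ →
                     ∣ (1 ÷ N) * (S₁ + S₂) - (1 ÷ P) * S₁ ∣ ≤ M ÷ N
  ∣mean-sub-mean∣≤ {zero} {suc _} ()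
  ∣mean-sub-mean∣≤ {suc N'} {suc P'} {M} N≡P+M _ {S₁} {S₂} 0≤S₁ S₁≤P 0≤S₂ S₂≤M =
    subst (λ d → ∣ d ∣ ≤ M ÷ suc N') (sym difference) (begin
      ∣ a * (S₂ - m * y) ∣      ≡⟨ ∣p*q∣≡∣p∣*∣q∣ a _ ⟩
      ∣ a ∣ * ∣ S₂ - m * y ∣    ≡⟨ cong (_* ∣ S₂ - m * y ∣) (0≤p⇒∣p∣≡p 0≤a) ⟩
      a * ∣ S₂ - m * y ∣        ≤⟨ *-monoˡ-≤-nonNeg a {{nonNegative 0≤a}} (-q≤p≤q⇒∣p∣≤q lower upper) ⟩
      a * m                     ≡⟨ *-comm a m ⟩
      m * a                     ≡⟨ sym (÷≡⟦⟧*1÷ M N') ⟩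
      M ÷ suc N'                ∎)
    where
    open ≤-Reasoning
    a b p m y : ℚ
    a = 1 ÷ suc N'
    b = 1 ÷ suc P'
    p = ⟦ suc P' ⟧
    m = ⟦ M ⟧
    y = b * S₁
    0≤a : 0ℚ ≤ a
    0≤a = ÷-nonNeg 1 (suc N')
    0≤b : 0ℚ ≤ b
    0≤b = ÷-nonNeg 1 (suc P')
    [p+m]*a≡1 : (p + m) * a ≡ 1ℚ
    [p+m]*a≡1 = trans (cong (_* a) (trans (sym (⟦⟧-homo-+ (suc P') M)) (cong ⟦_⟧ (sym N≡P+M)))) (⟦suc⟧*1÷suc≡1 N')
    S₁≡p*y : S₁ ≡ p * y
    S₁≡p*y = sym (trans (sym (*-assoc p b S₁)) (trans (cong (_* S₁) (⟦suc⟧*1÷suc≡1 P')) (*-identityˡ S₁)))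
    difference : a * (S₁ + S₂) - y ≡ a * (S₂ - m * y)
    difference = trans (cong₂ (λ u v → a * (u + S₂) - v) S₁≡p*y (sym (trans (cong (_* y) [p+m]*a≡1) (*-identityˡ y))))
      (solve 5 (λ a p m y s → a :* (p :* y :+ s) :- ((p :+ m) :* a) :* y := a :* (s :- m :* y)) refl a p m y S₂)
    0≤y : 0ℚ ≤ y
    0≤y = 0≤p*q 0≤b 0≤S₁
    y≤1 : y ≤ 1ℚ
    y≤1 = subst (y ≤_) (trans (*-comm b p) (⟦suc⟧*1÷suc≡1 P')) (*-monoˡ-≤-nonNeg b {{nonNegative 0≤b}} S₁≤P)
    0≤m : 0ℚ ≤ m
    0≤m = ⟦⟧-mono-≤ {0} {M} ℕ.z≤n
    m*y≤m : m * y ≤ m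
    m*y≤m = subst (m * y ≤_) (*-identityʳ m) (*-monoˡ-≤-nonNeg m {{nonNegative 0≤m}} y≤1)
    upper : S₂ - m * y ≤ m
    upper = ≤-trans (subst (S₂ - m * y ≤_) (+-identityʳ S₂) (+-monoʳ-≤ S₂ (neg-antimono-≤ (0≤p*q 0≤m 0≤y)))) S₂≤M
    lower : - m ≤ S₂ - m * y
    lower = subst (_≤ S₂ - m * y) (+-identityˡ (- m)) (+-mono-≤ 0≤S₂ (neg-antimono-≤ m*y≤m))

  mean : ∀ {a} {A : Set a} → (A → ℚ) → List A → ℚ
  mean f xs = (1 ÷ length xs) * sumℚ (L.map f xs)

  module _ {a p} {A : Set a} {P : Pred A p} (P? : Decidable P) where

    length-filter-partition : ∀ xs → length xs ≡ length (filter P? xs) ℕ.+ length (filter (¬? ∘ P?) xs)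
    length-filter-partition [] = refl
    length-filter-partition (x ∷ xs) with P? x
    ... | yes _ = cong suc (length-filter-partition xs)
    ... | no _ = trans (cong suc (length-filter-partition xs)) (sym (ℕ.+-suc _ _))

    sumℚ-filter-partition : ∀ (f : A → ℚ) xs →
      sumℚ (L.map f xs) ≡ sumℚ (L.map f (filter P? xs)) + sumℚ (L.map f (filter (¬? ∘ P?) xs))
    sumℚ-filter-partition f [] = refl
    sumℚ-filter-partition f (x ∷ xs) with P? x
    ... | yes _ = trans (cong (_+_ (f x)) (sumℚ-filter-partition f xs)) (sym (+-assoc (f x) _ _))
    ... | no _ = trans (cong (_+_ (f x)) (sumℚ-filter-partition f xs))
                       (solve 3 (λ x s t → x :+ (s :+ t) := s :+ (x :+ t)) refl (f x)
                         (sumℚ (L.map f (filter P? xs))) (sumℚ (L.map f (filter (¬? ∘ P?) xs))))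

    ∣mean-sub-mean-filter∣≤ : ∀ (f : A → ℚ) → (∀ x → 0ℚ ≤ f x) → (∀ x → f x ≤ 1ℚ) →
      ∀ xs → 0 ℕ.< length (filter P? xs) →
      ∣ mean f xs - mean f (filter P? xs) ∣ ≤ length (filter (¬? ∘ P?) xs) ÷ length xs
    ∣mean-sub-mean-filter∣≤ f f≥0 f≤1 xs 0<|ys| =
      subst (λ s → ∣ (1 ÷ length xs) * s - mean f ys ∣ ≤ length zs ÷ length xs)
            (sym (sumℚ-filter-partition f xs))
            (∣mean-sub-mean∣≤ (length-filter-partition xs) 0<|ys|
              (sumℚ-nonNeg f f≥0 ys) (sumℚ-≤-length f f≤1 ys) (sumℚ-nonNeg f f≥0 zs) (sumℚ-≤-length f f≤1 zs))
      where
      ys zs : List A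
      ys = filter P? xs
      zs = filter (¬? ∘ P?) xs

open CompositionCounts
open Means

open import Data.Nat using (ℕ; zero; suc; _≤_; _<_; _*_; _+_)
open import Data.Nat.Properties using (*-comm)
open import Data.Rational using (0ℚ; 1ℚ; ∣_∣; _-_) renaming (_≤_ to _≤ℚ_)
open import Data.Rational.Properties using (≤-trans)
open import Data.List using (List; length; filter)
open import Data.Vec using (Vec)
open import Data.List.Properties using (length-filter)
open import Function using (_∘_)
open import Relation.Binary.PropositionalEquality using (_≡_; sym; trans; cong; subst; subst₂)
open import Relation.Nullary.Decidable using (¬?)

0≤sliceDensity : ∀ k n A a → 0ℚ ≤ℚ sliceDensity k n A a
0≤sliceDensity k n A a = ÷-nonNeg _ (length (slice k n a))

sliceDensity≤1 : ∀ k n A a → sliceDensity k n A a ≤ℚ 1ℚ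
sliceDensity≤1 k n A a = ÷≤1 (length-filter _ (slice k n a))

degenerate-fraction≤ : ∀ j n → let cs = compositions (suc j) (suc n) in
  length (filter (¬? ∘ positive?) cs) ÷ length cs ≤ℚ (suc j * suc j) ÷ suc n
degenerate-fraction≤ j n = *≤*⇒÷≤÷ M (suc j * suc j) (length cs) n
  (subst₂ _≤_ (*-comm (suc n) M) (cong (suc j * suc j *_) (sym (length-compositions (suc j) (suc n))))
    (degenerate-bound j (suc n) M #comp≡#comp⁺+M))
  where
  cs : List (Vec ℕ (suc j))
  cs = compositions (suc j) (suc n)
  M : ℕ
  M = length (filter (¬? ∘ positive?) cs)
  #comp≡#comp⁺+M : #comp (suc j) (suc n) ≡ #comp⁺ (suc j) (suc n) + M
  #comp≡#comp⁺+M = trans (sym (length-compositions (suc j) (suc n)))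
    (trans (length-filter-partition positive? cs) (cong (_+ M) (length-positiveCompositions (suc j) (suc n))))

corollary3p3 : (k n : ℕ) → 1 ≤ k → k ≤ n → (A : Subset k n) →
    ∣ equalSlices k n A - nondegEqualSlices k n A ∣ ≤ℚ ((k * k) ÷ n)
corollary3p3 zero n () k≤n A
corollary3p3 (suc j) zero _ () A
corollary3p3 k@(suc j) n@(suc n') _ k≤n A = ≤-trans
  (∣mean-sub-mean-filter∣≤ positive? (sliceDensity k n A) (0≤sliceDensity k n A) (sliceDensity≤1 k n A)
    (compositions k n) (subst (0 <_) (sym (length-positiveCompositions k n)) (#comp⁺-pos j n k≤n)))
  (degenerate-fraction≤ j n')
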